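{- Let $\mathbf G$ be an isomorphism-invariant generalized edge random graph on $n$ vertices. Then $\mathbf G=\mathbf G(n,p)$ for some $p\in[0,1]$; that is, $\mathbf G$ is an Erdős–Rényi (edge) random graph.
   Context: For a positive integer $n$, $\mathcal G_n$ is the set of simple graphs with vertex set $[n]$; a random graph is a probability measure $P$ on $\mathcal G_n$. A generalized edge random graph $\mathbf G(n,\mathbf p)$, for a symmetric function $\mathbf p:[n]\times[n]\to[0,1]$, is the random graph with $P(G)=\prod_{i<j,\,ij\in E(G)}\mathbf p(i,j)\prod_{i<j,\,ij\notin E(G)}(1-\mathbf p(i,j))$. The Erdős–Rényi random graph $\mathbf G(n,p)$ is the case $\mathbf p\equiv p$. A random graph $(\mathcal G_n,P)$ is isomorphism-invariant if $P(G)=P(H)$ whenever $G,H\in\mathcal G_n$ are isomorphic. -}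

module Defs where

open import Level using (Level; _⊔_)
open import Data.Nat using (ℕ)
open import Data.Bool using (Bool; true; false; if_then_else_)
open import Data.Fin using (Fin; _<?_)
open import Data.List using (List; foldr; allFin)
open import Data.Product using (Σ; ∃; _×_; _,_)
open import Relation.Nullary using (does)
open import Relation.Binary.PropositionalEquality using (_≡_)
open import Relation.Binary.Structures using (IsTotalOrder)
open import Algebra.Bundles using (CommutativeRing)
open import Function.Bundles using (_↔_; Inverse)

record OrderedCommutativeRing (c ℓ₁ ℓ₂ : Level) : Set (Level.suc (c ⊔ ℓ₁ ⊔ ℓ₂)) where
  field
    commutativeRing : CommutativeRing c ℓ₁
  open CommutativeRing commutativeRing public
  field
    _≤_           : Carrier → Carrier → Set ℓ₂
    isTotalOrder  : IsTotalOrder _≈_ _≤_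
    +-mono-≤      : ∀ {x y} z → x ≤ y → (x + z) ≤ (y + z)
    *-nonneg      : ∀ {x y} → 0# ≤ x → 0# ≤ y → 0# ≤ (x * y)

record Graph (n : ℕ) : Set where
  field
    adj   : Fin n → Fin n → Bool
    sym   : ∀ i j → adj i j ≡ adj j i
    irrefl : ∀ i → adj i i ≡ false
open Graph public

Isomorphic : ∀ {n} → Graph n → Graph n → Set
Isomorphic {n} G H =
  Σ (Fin n ↔ Fin n) λ σ →
    ∀ i j → adj H (Inverse.to σ i) (Inverse.to σ j) ≡ adj G i j

module _ {c ℓ₁ ℓ₂} (R : OrderedCommutativeRing c ℓ₁ ℓ₂) where
  open OrderedCommutativeRing R

  ∏ : ∀ {a} {A : Set a} → List A → (A → Carrier) → Carrier
  ∏ xs f = foldr (λ x r → f x * r) 1# xs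

  ∏<  : ∀ n → (Fin n → Fin n → Carrier) → Carrier
  ∏< n f = ∏ (allFin n) λ i → ∏ (allFin n) λ j →
             if does (i <? j) then f i j else 1#

  -- A random graph on [n]: a function 𝒢ₙ → Carrier
  -- (the probability mass function P).
  RandomGraph : ℕ → Set c
  RandomGraph n = Graph n → Carrier

  edgeRandomGraph : ∀ n → (Fin n → Fin n → Carrier) → RandomGraph n
  edgeRandomGraph n p G =
    ∏< n λ i j → if adj G i j then p i j else (1# - p i j)

  erdosRenyi : ∀ n → Carrier → RandomGraph n
  erdosRenyi n p = edgeRandomGraph n (λ _ _ → p)

  IsEdgeProbability : ∀ n → (Fin n → Fin n → Carrier) → Set (ℓ₁ ⊔ ℓ₂)
  IsEdgeProbability n p =
    (∀ i j → p i j ≈ p j i) × (∀ i j → (0# ≤ p i j) × (p i j ≤ 1#))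

  IsomorphismInvariant : ∀ {n} → RandomGraph n → Set ℓ₁
  IsomorphismInvariant {n} P = ∀ (G H : Graph n) → Isomorphic G H → P G ≈ P H

module Submission where

-- The probability of the edge e is a marginal of the distribution: summing P over all graphs
-- that agree with a given one off e leaves the factor of e alone, since every other edge
-- contributes p + (1 − p) = 1.  Relabelling the vertices by σ permutes the factors, so
-- isomorphism invariance gives p(σ⁻¹a, σ⁻¹b) = p(a, b), and two transpositions carry any
-- pair a < b to 0 < 1.  Comparing single graphs instead would require cancelling products
-- that may vanish, which is why marginals are used.

open import Defs renaming (sym to adj-sym; irrefl to adj-irrefl)
open import Data.Nat using (ℕ; suc; z≤n; s≤s)
open import Data.Nat.Properties using (≤-trans)
open import Data.Bool using (Bool; true; false; if_then_else_)
open import Data.Fin using (Fin; zero; suc; _<_; _<?_; _≟_)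
open import Data.Fin.Properties using (<-asym; <-cmp; <⇒≢)
import Data.Fin.Permutation as Permutation
open import Data.Fin.Permutation.Components using (transpose)
open import Data.List using (List; []; _∷_; _++_; map; filter; cartesianProduct; allFin)
open import Data.List.Properties using (filter-all)
open import Data.List.Relation.Unary.All as All using (All; []; _∷_)
open import Data.List.Relation.Unary.All.Properties using (all-filter)
import Data.List.Relation.Unary.All.Properties as All
open import Data.List.Relation.Unary.Any as Any using (Any; here; there)
import Data.List.Relation.Unary.Any.Properties as Any
open import Data.List.Relation.Unary.AllPairs as AllPairs using (AllPairs; []; _∷_)
import Data.List.Relation.Unary.AllPairs.Properties as AllPairs
open import Data.List.Relation.Unary.Unique.Propositional using (Unique)
import Data.List.Relation.Unary.Unique.Propositional.Properties as Unique
open import Data.List.Membership.Propositional using (_∈_)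
open import Data.List.Membership.Propositional.Properties
  using (∈-filter⁺; ∈-filter⁻; ∈-cartesianProduct⁺; ∈-allFin)
open import Data.Product using (Σ; _×_; _,_; proj₁; proj₂; uncurry)
open import Data.Product.Properties using (≡-dec)
open import Data.Sum using (inj₁; inj₂)
open import Data.Empty using (⊥-elim)
open import Function using (_∘_; id)
open import Function.Bundles using (_↔_; Inverse)
open import Function.Construct.Identity using (↔-id)
open import Relation.Nullary using (Dec; yes; no; does; ¬?)
open import Relation.Nullary.Decidable using (dec-true; dec-false)
open import Relation.Binary.Definitions using (DecidableEquality; tri<; tri≈; tri>)
open import Relation.Binary.PropositionalEquality as ≡
  using (_≡_; _≢_; refl; cong; cong₂; ≢-sym)
open import Relation.Binary.Structures using (IsTotalOrder)

transpose-matchˡ : ∀ {n} (i j : Fin n) → transpose i j i ≡ j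
transpose-matchˡ i j rewrite dec-true (i ≟ i) refl = refl

transpose-matchʳ : ∀ {n} (i j : Fin n) → transpose i j j ≡ i
transpose-matchʳ i j with j ≟ i
... | yes j≡i = j≡i
... | no _ rewrite dec-true (j ≟ j) refl = refl

transpose-mismatch : ∀ {n} {i j k : Fin n} → k ≢ i → k ≢ j → transpose i j k ≡ k
transpose-mismatch {i = i} {j} {k} k≢i k≢j
  rewrite dec-false (k ≟ i) k≢i | dec-false (k ≟ j) k≢j = refl

module _ {n : ℕ} where

  Increasing : Fin n × Fin n → Set
  Increasing k = proj₁ k < proj₂ k

  increasing? : ∀ k → Dec (Increasing k)
  increasing? k = proj₁ k <? proj₂ k

  ordered : Fin n → Fin n → Fin n × Fin n
  ordered u v = if does (u <? v) then (u , v) else (v , u)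

  ordered-< : ∀ {u v} → u < v → ordered u v ≡ (u , v)
  ordered-< {u} {v} u<v rewrite dec-true (u <? v) u<v = refl

  ordered-> : ∀ {u v} → v < u → ordered u v ≡ (v , u)
  ordered-> {u} {v} v<u rewrite dec-false (u <? v) (<-asym v<u) = refl

  ordered-comm : ∀ {u v} → u ≢ v → ordered u v ≡ ordered v u
  ordered-comm {u} {v} u≢v with <-cmp u v
  ... | tri< u<v _ _ = ≡.trans (ordered-< u<v) (≡.sym (ordered-> u<v))
  ... | tri≈ _ u≡v _ = ⊥-elim (u≢v u≡v)
  ... | tri> _ _ v<u = ≡.trans (ordered-> v<u) (≡.sym (ordered-< v<u))

  ordered-increasing : ∀ {u v} → u ≢ v → Increasing (ordered u v)
  ordered-increasing {u} {v} u≢v with <-cmp u v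
  ... | tri< u<v _ _ rewrite ordered-< u<v = u<v
  ... | tri≈ _ u≡v _ = ⊥-elim (u≢v u≡v)
  ... | tri> _ _ v<u rewrite ordered-> v<u = v<u

  relabelPair : (Fin n → Fin n) → Fin n × Fin n → Fin n × Fin n
  relabelPair h k = ordered (h (proj₁ k)) (h (proj₂ k))

  relabelPair-ordered : ∀ h {u v} → h u ≢ h v → relabelPair h (ordered u v) ≡ ordered (h u) (h v)
  relabelPair-ordered h {u} {v} hu≢hv with <-cmp u v
  ... | tri< u<v _ _ rewrite ordered-< u<v = refl
  ... | tri≈ _ u≡v _ = ⊥-elim (hu≢hv (cong h u≡v))
  ... | tri> _ _ v<u rewrite ordered-> v<u = ordered-comm (hu≢hv ∘ ≡.sym)

  left-inverse⇒separates : (f g : Fin n → Fin n) → (∀ y → g (f y) ≡ y) →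
                           ∀ {k} → Increasing k → f (proj₁ k) ≢ f (proj₂ k)
  left-inverse⇒separates f g gf {a , b} a<b eq =
    <⇒≢ a<b (≡.trans (≡.sym (gf a)) (≡.trans (cong g eq) (gf b)))

  relabelPair-inverse : (f g : Fin n → Fin n) → (∀ y → f (g y) ≡ y) →
                        ∀ {k} → Increasing k → relabelPair f (relabelPair g k) ≡ k
  relabelPair-inverse f g fg {a , b} a<b = begin
    relabelPair f (ordered (g a) (g b))
      ≡⟨ relabelPair-ordered f (left-inverse⇒separates (f ∘ g) id fg a<b) ⟩
    ordered (f (g a)) (f (g b))         ≡⟨ cong₂ ordered (fg a) (fg b) ⟩
    ordered a b                         ≡⟨ ordered-< a<b ⟩
    (a , b)                             ∎
    where open ≡.≡-Reasoning

  pairs : List (Fin n × Fin n)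
  pairs = filter increasing? (cartesianProduct (allFin n) (allFin n))

  pairs-increasing : All Increasing pairs
  pairs-increasing = all-filter increasing? (cartesianProduct (allFin n) (allFin n))

  ∈-pairs : ∀ {k} → Increasing k → k ∈ pairs
  ∈-pairs {i , j} = ∈-filter⁺ increasing? (∈-cartesianProduct⁺ (∈-allFin i) (∈-allFin j))

  pairs-unique : Unique pairs
  pairs-unique = Unique.filter⁺ _ (Unique.cartesianProduct⁺ (Unique.allFin⁺ n) (Unique.allFin⁺ n))

  relabel : (Fin n → Fin n) → Graph n → Graph n
  relabel h G = record
    { adj    = λ i j → adj G (h i) (h j)
    ; sym    = λ i j → adj-sym G (h i) (h j)
    ; irrefl = λ i → adj-irrefl G (h i)
    }

  relabel-isomorphic : (σ : Fin n ↔ Fin n) (G : Graph n) → Isomorphic G (relabel (Inverse.from σ) G)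
  relabel-isomorphic σ G =
    σ , λ i j → cong₂ (adj G) (Inverse.strictlyInverseʳ σ i) (Inverse.strictlyInverseʳ σ j)

  graphOf : (Fin n × Fin n → Bool) → Graph n
  graphOf x = record
    { adj    = λ u v → if does (u ≟ v) then false else x (ordered u v)
    ; sym    = symmetric
    ; irrefl = λ u → ≡.cong (if_then false else x (ordered u u)) (dec-true (u ≟ u) refl)
    }
    where
      symmetric : ∀ u v → (if does (u ≟ v) then false else x (ordered u v))
                        ≡ (if does (v ≟ u) then false else x (ordered v u))
      symmetric u v with u ≟ v | v ≟ u
      ... | yes _ | yes _ = refl
      ... | yes u≡v | no v≢u = ⊥-elim (v≢u (≡.sym u≡v))
      ... | no u≢v | yes v≡u = ⊥-elim (u≢v (≡.sym v≡u))
      ... | no u≢v | no _ = cong x (ordered-comm u≢v)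

  graphOf-adj : ∀ x {u v} → u ≢ v → adj (graphOf x) u v ≡ x (ordered u v)
  graphOf-adj x {u} {v} u≢v rewrite dec-false (u ≟ v) u≢v = refl

module _ {c ℓ₁ ℓ₂} (R : OrderedCommutativeRing c ℓ₁ ℓ₂) where
  open OrderedCommutativeRing R hiding (zero) renaming (refl to ≈-refl)
  open import Relation.Binary.Reasoning.Setoid setoid
  open import Algebra.Properties.Ring ring using (-1*x≈-x; -‿involutive)
  open import Algebra.Properties.AbelianGroup +-abelianGroup using (xyx⁻¹≈y)
  private module ≤ = IsTotalOrder isTotalOrder

  -- If 1 ≤ 0 then 0 ≤ -1, so 0 ≤ (-1)(-1) = 1.
  0≤1 : 0# ≤ 1#
  0≤1 with ≤.total 0# 1#
  ... | inj₁ 0≤1 = 0≤1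
  ... | inj₂ 1≤0 =
    ≤.trans (*-nonneg 0≤-1 0≤-1) (≤.reflexive (trans (-1*x≈-x (- 1#)) (-‿involutive 1#)))
    where
      0≤-1 : 0# ≤ (- 1#)
      0≤-1 = ≤.trans (≤.reflexive (sym (-‿inverseʳ 1#)))
               (≤.trans (+-mono-≤ (- 1#) 1≤0) (≤.reflexive (+-identityˡ (- 1#))))

  edgeFactor : Carrier → Bool → Carrier
  edgeFactor q v = if v then q else 1# - q

  edgeFactor-total : ∀ q → edgeFactor q true + edgeFactor q false ≈ 1#
  edgeFactor-total q = trans (sym (+-assoc q 1# (- q))) (xyx⁻¹≈y q 1#)

  edgeFactor-cong : ∀ {q q′} v → q ≈ q′ → edgeFactor q v ≈ edgeFactor q′ v
  edgeFactor-cong true  q≈q′ = q≈q′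
  edgeFactor-cong false q≈q′ = +-congˡ (-‿cong q≈q′)

  ∏-cong : ∀ {A : Set} {xs : List A} {f g : A → Carrier} →
           All (λ x → f x ≈ g x) xs → ∏ R xs f ≈ ∏ R xs g
  ∏-cong []         = ≈-refl
  ∏-cong (fx≈gx ∷ eqs) = *-cong fx≈gx (∏-cong eqs)

  ∏-++ : ∀ {A : Set} (xs ys : List A) (f : A → Carrier) → ∏ R (xs ++ ys) f ≈ ∏ R xs f * ∏ R ys f
  ∏-++ []       ys f = sym (*-identityˡ _)
  ∏-++ (x ∷ xs) ys f = trans (*-congˡ (∏-++ xs ys f)) (sym (*-assoc _ _ _))

  ∏-map : ∀ {A B : Set} (g : A → B) (xs : List A) (f : B → Carrier) →
          ∏ R (map g xs) f ≡ ∏ R xs (f ∘ g)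
  ∏-map g []       f = refl
  ∏-map g (x ∷ xs) f = cong (f (g x) *_) (∏-map g xs f)

  ∏-cartesianProduct : ∀ {A B : Set} (xs : List A) (ys : List B) (f : A × B → Carrier) →
                       ∏ R (cartesianProduct xs ys) f ≈ ∏ R xs (λ a → ∏ R ys (λ b → f (a , b)))
  ∏-cartesianProduct []       ys f = ≈-refl
  ∏-cartesianProduct (x ∷ xs) ys f = begin
    ∏ R (map (x ,_) ys ++ cartesianProduct xs ys) f  ≈⟨ ∏-++ (map (x ,_) ys) _ f ⟩
    ∏ R (map (x ,_) ys) f * ∏ R (cartesianProduct xs ys) f
      ≈⟨ *-cong (reflexive (∏-map (x ,_) ys f)) (∏-cartesianProduct xs ys f) ⟩
    ∏ R ys (λ b → f (x , b)) * ∏ R xs (λ a → ∏ R ys (λ b → f (a , b)))  ∎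

  ∏-filter : ∀ {A : Set} {P : A → Set} (P? : ∀ a → Dec (P a)) (xs : List A) (f : A → Carrier) →
             ∏ R (filter P? xs) f ≈ ∏ R xs (λ a → if does (P? a) then f a else 1#)
  ∏-filter P? []       f = ≈-refl
  ∏-filter P? (x ∷ xs) f with does (P? x)
  ... | true  = *-congˡ (∏-filter P? xs f)
  ... | false = trans (∏-filter P? xs f) (sym (*-identityˡ _))

  ∏<-pairs : ∀ n (f : Fin n → Fin n → Carrier) → ∏< R n f ≈ ∏ R pairs (uncurry f)
  ∏<-pairs n f = sym (begin
    ∏ R pairs (uncurry f)
      ≈⟨ ∏-filter increasing? (cartesianProduct (allFin n) (allFin n)) (uncurry f) ⟩
    ∏ R (cartesianProduct (allFin n) (allFin n)) (λ k → if does (increasing? k) then uncurry f k else 1#)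
      ≈⟨ ∏-cartesianProduct (allFin n) (allFin n) _ ⟩
    ∏< R n f ∎)

  edgeRandomGraph-cong : ∀ {n} {p p′ : Fin n → Fin n → Carrier} →
                         (∀ {i j} → i < j → p i j ≈ p′ i j) →
                         ∀ G → edgeRandomGraph R n p G ≈ edgeRandomGraph R n p′ G
  edgeRandomGraph-cong {n} {p} {p′} p≈p′ G = begin
    edgeRandomGraph R n p G  ≈⟨ ∏<-pairs n _ ⟩
    ∏ R pairs (λ k → edgeFactor (uncurry p k) (adj G (proj₁ k) (proj₂ k)))
      ≈⟨ ∏-cong (All.map (λ i<j → edgeFactor-cong _ (p≈p′ i<j)) pairs-increasing) ⟩
    ∏ R pairs (λ k → edgeFactor (uncurry p′ k) (adj G (proj₁ k) (proj₂ k)))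
      ≈⟨ sym (∏<-pairs n _) ⟩
    edgeRandomGraph R n p′ G ∎

  module Marginalisation {C : Set} (_≟ᶜ_ : DecidableEquality C) where

    _[_≔_] : (C → Bool) → C → Bool → C → Bool
    x [ c ≔ v ] = λ d → if does (d ≟ᶜ c) then v else x d

    update-≢ : ∀ x {c d} v → d ≢ c → (x [ c ≔ v ]) d ≡ x d
    update-≢ x {c} {d} v d≢c rewrite dec-false (d ≟ᶜ c) d≢c = refl

    -- sumOver cs h x sums h over the 2^|cs| assignments that agree with x off cs.
    sumOver : List C → ((C → Bool) → Carrier) → (C → Bool) → Carrier
    sumOver []       h = h
    sumOver (c ∷ cs) h = sumOver cs (λ y → h (y [ c ≔ true ]) + h (y [ c ≔ false ]))

    sumOver-cong : ∀ cs {h h′} → (∀ y → h y ≈ h′ y) → ∀ x → sumOver cs h x ≈ sumOver cs h′ x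
    sumOver-cong []       h≈h′ = h≈h′
    sumOver-cong (c ∷ cs) h≈h′ = sumOver-cong cs (λ y → +-cong (h≈h′ _) (h≈h′ _))

    module Factorised {I : Set} (κ : I → C) (ψ : I → Bool → Carrier)
                      (ψ-total : ∀ k → ψ k true + ψ k false ≈ 1#) where

      ∏ψ : List I → (C → Bool) → Carrier
      ∏ψ qs x = ∏ R qs (λ k → ψ k (x (κ k)))

      Distinct : List I → Set
      Distinct = AllPairs (λ k k′ → κ k ≢ κ k′)

      Occurs : C → List I → Set
      Occurs c = Any (λ k → κ k ≡ c)

      remove : C → List I → List I
      remove c = filter (λ k → ¬? (κ k ≟ᶜ c))

      ∏ψ-update : ∀ {c} v qs x → All (λ k → κ k ≢ c) qs → ∏ψ qs (x [ c ≔ v ]) ≡ ∏ψ qs x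
      ∏ψ-update v []       x []          = refl
      ∏ψ-update v (k ∷ qs) x (κk≢c ∷ ne) =
        cong₂ (λ a b → ψ k a * b) (update-≢ x v κk≢c) (∏ψ-update v qs x ne)

      ∏ψ-sum : ∀ {c} qs → Distinct qs → Occurs c qs → ∀ x →
               ∏ψ qs (x [ c ≔ true ]) + ∏ψ qs (x [ c ≔ false ]) ≈ ∏ψ (remove c qs) x
      ∏ψ-sum {c} (k ∷ qs) (κk∉qs ∷ d) occ x with κ k ≟ᶜ c
      ... | yes κk≡c = begin
        ψ k true * ∏ψ qs (x [ c ≔ true ]) + ψ k false * ∏ψ qs (x [ c ≔ false ])
          ≡⟨ cong₂ (λ a b → ψ k true * a + ψ k false * b)
                   (∏ψ-update true qs x others) (∏ψ-update false qs x others) ⟩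
        ψ k true * ∏ψ qs x + ψ k false * ∏ψ qs x  ≈⟨ sym (distribʳ _ _ _) ⟩
        (ψ k true + ψ k false) * ∏ψ qs x          ≈⟨ *-congʳ (ψ-total k) ⟩
        1# * ∏ψ qs x                              ≈⟨ *-identityˡ _ ⟩
        ∏ψ qs x                                   ≡⟨ cong (λ ks → ∏ψ ks x) (≡.sym (filter-all _ others)) ⟩
        ∏ψ (remove c qs) x                        ∎
        where
          others : All (λ k′ → κ k′ ≢ c) qs
          others = All.map (λ κk≢κk′ κk′≡c → κk≢κk′ (≡.trans κk≡c (≡.sym κk′≡c))) κk∉qs
      ... | no κk≢c with occ
      ...   | here κk≡c  = ⊥-elim (κk≢c κk≡c)
      ...   | there occ′ = begin
        ψ k (x (κ k)) * ∏ψ qs (x [ c ≔ true ]) + ψ k (x (κ k)) * ∏ψ qs (x [ c ≔ false ])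
          ≈⟨ sym (distribˡ _ _ _) ⟩
        ψ k (x (κ k)) * (∏ψ qs (x [ c ≔ true ]) + ∏ψ qs (x [ c ≔ false ]))
          ≈⟨ *-congˡ (∏ψ-sum qs d occ′ x) ⟩
        ψ k (x (κ k)) * ∏ψ (remove c qs) x  ∎

      Occurs-remove : ∀ {c d} qs → c ≢ d → Occurs d qs → Occurs d (remove c qs)
      Occurs-remove {c} qs c≢d occ with Any.filter⁺ (λ k → ¬? (κ k ≟ᶜ c)) occ
      ... | inj₁ occ′   = occ′
      ... | inj₂ ¬κk≢c =
        ⊥-elim (¬κk≢c (λ κk≡c → c≢d (≡.trans (≡.sym κk≡c) (Any.lookup-result occ))))

      -- The hypotheses say that κ maps qs bijectively onto e ∷ cs.
      marginal : ∀ e cs qs → Distinct qs → Unique (e ∷ cs) → All (λ c → Occurs c qs) (e ∷ cs) →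
                 All (λ k → κ k ∈ e ∷ cs) qs →
                 Σ I λ k → k ∈ qs × κ k ≡ e × (∀ x → sumOver cs (∏ψ qs) x ≈ ψ k (x e))
      marginal e [] [] _ _ (() ∷ []) []
      marginal e [] (k ∷ []) _ _ _ (here κk≡e ∷ []) =
        k , here refl , κk≡e , λ x → trans (*-identityʳ _) (reflexive (cong (ψ k ∘ x) κk≡e))
      marginal e [] (k ∷ k′ ∷ _) ((κk≢κk′ ∷ _) ∷ _) _ _ (here κk≡e ∷ here κk′≡e ∷ _) =
        ⊥-elim (κk≢κk′ (≡.trans κk≡e (≡.sym κk′≡e)))
      marginal e (c ∷ cs) qs d ((e≢c ∷ e∉cs) ∷ c∉cs ∷ u) (occ-e ∷ occ-c ∷ occ-cs) cover
        with marginal e cs (remove c qs) (AllPairs.filter⁺ _ d) (e∉cs ∷ u)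
               (All.zipWith (uncurry (Occurs-remove qs)) (≢-sym e≢c ∷ c∉cs , occ-e ∷ occ-cs))
               (All.zipWith (uncurry drop-c) (All.filter⁺ _ cover , all-filter _ qs))
        where
          drop-c : ∀ {a} → a ∈ e ∷ c ∷ cs → a ≢ c → a ∈ e ∷ cs
          drop-c (here a≡e)          _   = here a≡e
          drop-c (there (here a≡c))  a≢c = ⊥-elim (a≢c a≡c)
          drop-c (there (there a∈cs)) _  = there a∈cs
      ... | k , k∈ , κk≡e , sum≈ψ =
        k , proj₁ (∈-filter⁻ _ k∈) , κk≡e ,
        λ x → trans (sumOver-cong cs (∏ψ-sum qs d occ-c) x) (sum≈ψ x)

  module EdgeMarginals {n : ℕ} (p : Fin n → Fin n → Carrier) where
    _≟ₚ_ : DecidableEquality (Fin n × Fin n)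
    _≟ₚ_ = ≡-dec _≟_ _≟_

    open Marginalisation _≟ₚ_

    ψ : Fin n × Fin n → Bool → Carrier
    ψ k = edgeFactor (uncurry p k)

    others : Fin n × Fin n → List (Fin n × Fin n)
    others e = filter (λ k → ¬? (k ≟ₚ e)) pairs

    module Relabelled (σ : Fin n ↔ Fin n) where
      open Inverse σ using (to; from; strictlyInverseˡ; strictlyInverseʳ)

      κ : Fin n × Fin n → Fin n × Fin n
      κ = relabelPair from

      open Factorised κ ψ (λ k → edgeFactor-total (uncurry p k))

      κ-injective : ∀ {k k′} → Increasing k → Increasing k′ → κ k ≡ κ k′ → k ≡ k′
      κ-injective inc inc′ eq = ≡.trans (≡.sym (relabelPair-inverse to from strictlyInverseˡ inc))
        (≡.trans (cong (relabelPair to) eq) (relabelPair-inverse to from strictlyInverseˡ inc′))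

      from-separates : ∀ {k} → Increasing k → from (proj₁ k) ≢ from (proj₂ k)
      from-separates = left-inverse⇒separates from to strictlyInverseˡ

      κ-increasing : ∀ {k} → Increasing k → Increasing (κ k)
      κ-increasing = ordered-increasing ∘ from-separates

      distinct : ∀ {qs} → Unique qs → All Increasing qs → Distinct qs
      distinct []          []           = []
      distinct (k∉qs ∷ u) (inc ∷ incs) =
        All.zipWith (λ (k≢k′ , inc′) → k≢k′ ∘ κ-injective inc inc′) (k∉qs , incs) ∷ distinct u incs

      occurs : ∀ {c} → Increasing c → Occurs c pairs
      occurs inc = Any.map (λ { refl → relabelPair-inverse from to strictlyInverseʳ inc })
                           (∈-pairs (ordered-increasing (left-inverse⇒separates to from strictlyInverseʳ inc)))

      relabelled : (Fin n × Fin n → Bool) → Graph n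
      relabelled x = relabel from (graphOf x)

      edgeRandomGraph-relabelled : ∀ x → edgeRandomGraph R n p (relabelled x) ≈ ∏ψ pairs x
      edgeRandomGraph-relabelled x = trans (∏<-pairs n _)
        (∏-cong (All.map (λ inc → reflexive (cong (ψ _) (graphOf-adj x (from-separates inc))))
                         pairs-increasing))

      marginal-relabelled : ∀ {k e} → Increasing k → κ k ≡ e → ∀ x →
                            sumOver (others e) (edgeRandomGraph R n p ∘ relabelled) x ≈ ψ k (x e)
      marginal-relabelled {k} {e} inc refl x
        with marginal e (others e) pairs (distinct pairs-unique pairs-increasing)
               (All.map ≢-sym (all-filter _ pairs) ∷ Unique.filter⁺ _ pairs-unique)
               (occurs (κ-increasing inc) ∷ All.map occurs (All.filter⁺ _ pairs-increasing))
               (All.map covered pairs-increasing)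
        where
          covered : ∀ {k′} → Increasing k′ → κ k′ ∈ e ∷ others e
          covered {k′} inc′ with κ k′ ≟ₚ e
          ... | yes κk′≡e = here κk′≡e
          ... | no κk′≢e  = there (∈-filter⁺ _ (∈-pairs (κ-increasing inc′)) κk′≢e)
      ... | k′ , k′∈pairs , κk′≡e , sum≈ψ
        rewrite κ-injective (All.lookup pairs-increasing k′∈pairs) inc κk′≡e =
          trans (sumOver-cong (others e) edgeRandomGraph-relabelled x) (sum≈ψ x)

    p-ordered : (∀ i j → p i j ≈ p j i) → ∀ u v → uncurry p (ordered u v) ≈ p u v
    p-ordered p-sym u v with does (u <? v)
    ... | true  = ≈-refl
    ... | false = p-sym v u

    relabel-invariance : (∀ i j → p i j ≈ p j i) → IsomorphismInvariant R (edgeRandomGraph R n p) →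
                         (σ : Fin n ↔ Fin n) → ∀ {a b} → a < b →
                         p (Inverse.from σ a) (Inverse.from σ b) ≈ p a b
    relabel-invariance p-sym invariant σ {a} {b} a<b = begin
      p (Inverse.from σ a) (Inverse.from σ b)
        ≈⟨ sym (p-ordered p-sym _ _) ⟩
      uncurry p e
        ≈⟨ sym (Id.marginal-relabelled e-increasing (ordered-< e-increasing) all-true) ⟩
      sumOver (others e) (edgeRandomGraph R n p ∘ Id.relabelled) all-true
        ≈⟨ sumOver-cong (others e) relabelled-≈ all-true ⟩
      sumOver (others e) (edgeRandomGraph R n p ∘ Rσ.relabelled) all-true
        ≈⟨ Rσ.marginal-relabelled a<b refl all-true ⟩
      p a b ∎
      where
        module Id = Relabelled (↔-id (Fin n))
        module Rσ = Relabelled σ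

        e : Fin n × Fin n
        e = Rσ.κ (a , b)

        e-increasing : Increasing e
        e-increasing = Rσ.κ-increasing a<b

        all-true : Fin n × Fin n → Bool
        all-true _ = true

        relabelled-≈ : ∀ y → edgeRandomGraph R n p (Id.relabelled y)
                           ≈ edgeRandomGraph R n p (Rσ.relabelled y)
        relabelled-≈ y =
          trans (sym (invariant (graphOf y) (Id.relabelled y) (relabel-isomorphic (↔-id (Fin n)) (graphOf y))))
                (invariant (graphOf y) (Rσ.relabelled y) (relabel-isomorphic σ (graphOf y)))

  edgeProbability-constant : ∀ n (p : Fin n → Fin n → Carrier) → IsEdgeProbability R n p →
                             IsomorphismInvariant R (edgeRandomGraph R n p) →
                             Σ Carrier λ q → (0# ≤ q × q ≤ 1#) × (∀ {a b} → a < b → p a b ≈ q)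
  edgeProbability-constant 0 p _ _ = 0# , (≤.refl , 0≤1) , λ { {()} }
  edgeProbability-constant 1 p _ _ = 0# , (≤.refl , 0≤1) , λ { {zero} {zero} () }
  edgeProbability-constant (suc (suc m)) p (p-sym , p-bounded) invariant =
    p zero (suc zero) , p-bounded zero (suc zero) , p≈p₀₁
    where
      open EdgeMarginals p using (relabel-invariance)

      p≈p₀₁ : ∀ {a b} → a < b → p a b ≈ p zero (suc zero)
      p≈p₀₁ {a} {b} a<b = begin
        p a b
          ≡⟨ cong₂ p (≡.sym (transpose-matchˡ zero a))
                     (≡.sym (transpose-mismatch (≢-sym 0≢b) (≢-sym (<⇒≢ a<b)))) ⟩
        p (transpose zero a zero) (transpose zero a b)
          ≈⟨ relabel-invariance p-sym invariant (Permutation.transpose a zero) 0<b ⟩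
        p zero b
          ≈⟨ sym (relabel-invariance p-sym invariant (Permutation.transpose b (suc zero)) 0<b) ⟩
        p (transpose (suc zero) b zero) (transpose (suc zero) b b)
          ≡⟨ cong₂ p (transpose-mismatch {i = suc zero} (λ ()) 0≢b) (transpose-matchʳ (suc zero) b) ⟩
        p zero (suc zero) ∎
        where
          0<b : zero {suc m} < b
          0<b = ≤-trans (s≤s z≤n) a<b

          0≢b : zero ≢ b
          0≢b = <⇒≢ 0<b

proposition2p8 : ∀ {c ℓ₁ ℓ₂} (R : OrderedCommutativeRing c ℓ₁ ℓ₂) (n : ℕ)
    (p : Fin n → Fin n → OrderedCommutativeRing.Carrier R) →
    IsEdgeProbability R n p →
    IsomorphismInvariant R (edgeRandomGraph R n p) →
    Σ (OrderedCommutativeRing.Carrier R) λ q →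
      (OrderedCommutativeRing._≤_ R (OrderedCommutativeRing.0# R) q
        × OrderedCommutativeRing._≤_ R q (OrderedCommutativeRing.1# R))
      × (∀ (G : Graph n) →
          OrderedCommutativeRing._≈_ R (edgeRandomGraph R n p G) (erdosRenyi R n q G))
proposition2p8 R n p isEdgeProbability invariant
  with edgeProbability-constant R n p isEdgeProbability invariant
... | q , q∈[0,1] , p≈q = q , q∈[0,1] , edgeRandomGraph-cong R p≈q
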